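{- Let $n\ge 5$ and $q\ge 1$. The clique number $\omega(A\Gamma_n^q)$ and the chromatic number $\chi(A\Gamma_n^q)$ satisfy $\omega(A\Gamma_n^q)=\chi(A\Gamma_n^q)=n$.
   Context: $X=\{1,\dots,n\}$, $A_n$ the alternating group on $X$, $\mathcal{E}_n=\{\sigma\in A_n: i^\sigma\neq i \text{ for all } i\in X\}$. $A\Gamma_n$ is the Cayley graph $\Gamma(A_n,\mathcal{E}_n)$ (vertex set $A_n$, edges $\{g,sg\}$, $s\in\mathcal{E}_n$). $A\Gamma_n^q$ is the tensor product of $q$ copies of $A\Gamma_n$: vertex set $A_n^q$, with $(\sigma_1,\dots,\sigma_q)$ adjacent to $(\tau_1,\dots,\tau_q)$ iff $\sigma_k$ is adjacent to $\tau_k$ in $A\Gamma_n$ for every $k$. -}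

module Defs where

open import Data.Nat using (ℕ; _≤_; _<ᵇ_)
open import Data.Nat.Divisibility using (_∣_)
open import Data.Fin using (Fin; toℕ)
open import Data.Fin.Permutation using (Permutation′; _⟨$⟩ʳ_)
open import Data.List using (List; length; filterᵇ; cartesianProduct; allFin)
open import Data.Bool using (_∧_)
open import Data.Product using (Σ; ∃; _×_; _,_; proj₁)
open import Data.Sum using (_⊎_)
open import Relation.Binary.PropositionalEquality using (_≡_; _≢_)
open import Relation.Nullary using (¬_)

Perm : ℕ → Set
Perm n = Permutation′ n

_≈ₚ_ : ∀ {n} → Perm n → Perm n → Set
σ ≈ₚ τ = ∀ i → σ ⟨$⟩ʳ i ≡ τ ⟨$⟩ʳ i

inversions : ∀ {n} → Perm n → ℕ
inversions {n} σ =
  length (filterᵇ (λ p → (toℕ (proj₁ p) <ᵇ toℕ (Data.Product.proj₂ p))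
                        ∧ (toℕ (σ ⟨$⟩ʳ Data.Product.proj₂ p) <ᵇ toℕ (σ ⟨$⟩ʳ proj₁ p)))
                  (cartesianProduct (allFin n) (allFin n)))

IsEven : ∀ {n} → Perm n → Set
IsEven σ = 2 ∣ inversions σ

Alt : ℕ → Set
Alt n = Σ (Perm n) IsEven

_≈ₐ_ : ∀ {n} → Alt n → Alt n → Set
a ≈ₐ b = proj₁ a ≈ₚ proj₁ b

FixedPointFree : ∀ {n} → Perm n → Set
FixedPointFree σ = ∀ i → σ ⟨$⟩ʳ i ≢ i

InE : ∀ {n} → Alt n → Set
InE s = FixedPointFree (proj₁ s)

-- Products act on the right: i^(s g) = (i^s)^g, so h = s g means
-- h(i) = g(s(i)) for all i.
IsProd : ∀ {n} → Alt n → Alt n → Alt n → Set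
IsProd h s g = ∀ i → proj₁ h ⟨$⟩ʳ i ≡ proj₁ g ⟨$⟩ʳ (proj₁ s ⟨$⟩ʳ i)

AΓ-Adj : ∀ {n} → Alt n → Alt n → Set
AΓ-Adj g h = (∃ λ s → InE s × IsProd h s g) ⊎ (∃ λ s → InE s × IsProd g s h)

-- q-fold tensor power: vertices A_n^q, adjacency coordinatewise
Vtx : ℕ → ℕ → Set
Vtx n q = Fin q → Alt n

_≈ᵥ_ : ∀ {n q} → Vtx n q → Vtx n q → Set
u ≈ᵥ v = ∀ k → u k ≈ₐ v k

AΓq-Adj : ∀ {n q} → Vtx n q → Vtx n q → Set
AΓq-Adj u v = ∀ k → AΓ-Adj (u k) (v k)

IsClique : {V : Set} (_≈_ : V → V → Set) (Adj : V → V → Set) (m : ℕ) →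
           (Fin m → V) → Set
IsClique _≈_ Adj m c = ∀ i j → i ≢ j → ¬ (c i ≈ c j) × Adj (c i) (c j)

IsCliqueNumber : {V : Set} (_≈_ : V → V → Set) (Adj : V → V → Set) → ℕ → Set
IsCliqueNumber {V} _≈_ Adj ω =
  (Σ (Fin ω → V) (IsClique _≈_ Adj ω)) ×
  (∀ m (c : Fin m → V) → IsClique _≈_ Adj m c → m ≤ ω)

IsProperColouring : {V : Set} (Adj : V → V → Set) (m : ℕ) → (V → Fin m) → Set
IsProperColouring Adj m f = ∀ u v → Adj u v → f u ≢ f v

IsChromaticNumber : {V : Set} (Adj : V → V → Set) → ℕ → Set
IsChromaticNumber {V} Adj χ =
  (Σ (V → Fin χ) (IsProperColouring Adj χ)) ×
  (∀ m (f : V → Fin m) → IsProperColouring Adj m f → χ ≤ m)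

module Submission where

-- Even permutations g and h are adjacent in AΓ_n exactly when they disagree at every point:
-- the connecting element s with h = s g is fixed-point-free iff h(x) ≢ g(x) for all x, and it
-- is automatically even since the sign is multiplicative.  So "the value at the point 0 of
-- the first coordinate" is a proper n-colouring of AΓ_n^q, while n pairwise everywhere-
-- disagreeing even permutations (the rows of a Latin square), used constantly in every
-- coordinate, form an n-clique.  By pigeonhole a clique and a proper colouring of the same
-- size n force ω = χ = n.

open import Defs
open import Data.Bool using (Bool; true; false; not; _∧_; _xor_)
open import Data.Bool.Properties using (∧-distribˡ-xor; xor-assoc; xor-same; xor-identityʳ; not-involutive)
open import Data.Empty using (⊥-elim)
open import Data.Fin using (Fin; toℕ; zero; suc; fromℕ; inject₁)
open import Data.Fin.Permutation
  using (Permutation′; _⟨$⟩ʳ_; _⟨$⟩ˡ_; inverseˡ; inverseʳ; _∘ₚ_; flip; permutation)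
  renaming (id to idₚ)
open import Data.Fin.Properties
  using (toℕ-injective; toℕ-fromℕ; toℕ-inject₁; toℕ<n; pigeonhole; <⇒≢; _≟_)
open import Data.List using (List; []; _∷_; _++_; map; length; filterᵇ; cartesianProduct; tabulate; allFin)
open import Data.Nat using (ℕ; zero; suc; _+_; _*_; _<ᵇ_; _≤_; _<_; s≤s; z≤n; _≤?_; parity)
open import Data.Nat.DivMod using (_%_; m<n⇒m%n≡m; [m+kn]%n≡m%n)
open import Data.Nat.Divisibility using (_∣_; divides)
open import Data.Nat.Properties
  using (+-0-commutativeMonoid; +-*-semiring; +-comm; +-assoc; +-identityʳ; *-identityʳ; *-zeroʳ;
         *-cancelˡ-≡; +-cancelˡ-≡; ≰⇒>)
open import Data.Nat.Tactic.RingSolver using (solve-∀)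
open import Algebra.Properties.CommutativeMonoid.Sum +-0-commutativeMonoid
  using (sum; sum-cong-≗; ∑-distrib-+; ∑-comm; sum-permute)
open import Algebra.Properties.Semiring.Sum +-*-semiring using (*-distribˡ-sum)
open import Data.Parity.Base as ℙ using (Parity; 0ℙ; 1ℙ)
import Data.Parity.Properties as ℙ
open import Data.Product using (Σ; _×_; _,_; ∃; proj₁; proj₂)
open import Data.Sum using (inj₁; inj₂)
open import Function using (_∘_; id)
open import Function.Definitions using (Injective)
open import Relation.Binary.PropositionalEquality
open import Relation.Nullary using (yes; no)

𝟙 : Bool → ℕ
𝟙 true  = 1
𝟙 false = 0

count : {A : Set} → (A → Bool) → List A → ℕ
count p []       = 0
count p (x ∷ xs) = 𝟙 (p x) + count p xs

length-filterᵇ : {A : Set} (p : A → Bool) (xs : List A) → length (filterᵇ p xs) ≡ count p xs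
length-filterᵇ p [] = refl
length-filterᵇ p (x ∷ xs) with p x
... | true  = cong suc (length-filterᵇ p xs)
... | false = length-filterᵇ p xs

count-++ : {A : Set} (p : A → Bool) (xs ys : List A) → count p (xs ++ ys) ≡ count p xs + count p ys
count-++ p []       ys = refl
count-++ p (x ∷ xs) ys = trans (cong (𝟙 (p x) +_) (count-++ p xs ys)) (sym (+-assoc (𝟙 (p x)) _ _))

count-map : {A B : Set} (p : B → Bool) (f : A → B) (xs : List A) → count p (map f xs) ≡ count (p ∘ f) xs
count-map p f []       = refl
count-map p f (x ∷ xs) = cong (𝟙 (p (f x)) +_) (count-map p f xs)

count-tabulate : {A : Set} {n : ℕ} (p : A → Bool) (f : Fin n → A) → count p (tabulate f) ≡ sum (𝟙 ∘ p ∘ f)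
count-tabulate {n = zero}  p f = refl
count-tabulate {n = suc n} p f = cong (𝟙 (p (f zero)) +_) (count-tabulate p (f ∘ suc))

count-cartesianProduct : {A B : Set} {n : ℕ} (p : A × B → Bool) (f : Fin n → A) (ys : List B) →
  count p (cartesianProduct (tabulate f) ys) ≡ sum (λ i → count (λ y → p (f i , y)) ys)
count-cartesianProduct {n = zero}  p f ys = refl
count-cartesianProduct {n = suc n} p f ys = begin
    count p (map (f zero ,_) ys ++ cartesianProduct (tabulate (f ∘ suc)) ys)
  ≡⟨ count-++ p (map (f zero ,_) ys) _ ⟩
    count p (map (f zero ,_) ys) + count p (cartesianProduct (tabulate (f ∘ suc)) ys)
  ≡⟨ cong₂ _+_ (count-map p (f zero ,_) ys) (count-cartesianProduct p (f ∘ suc) ys) ⟩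
    count (λ y → p (f zero , y)) ys + sum (λ i → count (λ y → p (f (suc i) , y)) ys) ∎
  where open ≡-Reasoning

infix 7 _<ᶠ_
_<ᶠ_ : {n : ℕ} → Fin n → Fin n → Bool
i <ᶠ j = toℕ i <ᵇ toℕ j

<ᵇ-irrefl : ∀ m → (m <ᵇ m) ≡ false
<ᵇ-irrefl zero    = refl
<ᵇ-irrefl (suc m) = <ᵇ-irrefl m

<ᵇ-asym : ∀ m n → ((m <ᵇ n) ∧ (n <ᵇ m)) ≡ false
<ᵇ-asym zero    zero    = refl
<ᵇ-asym zero    (suc n) = refl
<ᵇ-asym (suc m) zero    = refl
<ᵇ-asym (suc m) (suc n) = <ᵇ-asym m n

<ᵇ-flip : ∀ m n → m ≢ n → (n <ᵇ m) ≡ not (m <ᵇ n)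
<ᵇ-flip zero    zero    m≢n = ⊥-elim (m≢n refl)
<ᵇ-flip zero    (suc n) m≢n = refl
<ᵇ-flip (suc m) zero    m≢n = refl
<ᵇ-flip (suc m) (suc n) m≢n = <ᵇ-flip m n (m≢n ∘ cong suc)

<ᵇ-tri : ∀ m n → (m <ᵇ n) ≡ false → (n <ᵇ m) ≡ false → m ≡ n
<ᵇ-tri zero    zero    _  _  = refl
<ᵇ-tri zero    (suc n) () _
<ᵇ-tri (suc m) zero    _  ()
<ᵇ-tri (suc m) (suc n) p  q  = cong suc (<ᵇ-tri m n p q)

count₂ : {n : ℕ} → (Fin n → Fin n → Bool) → ℕ
count₂ P = sum (λ i → sum (λ j → 𝟙 (P i j)))

inv : {n : ℕ} → (Fin n → Fin n) → ℕ
inv f = count₂ (λ i j → i <ᶠ j ∧ f j <ᶠ f i)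

inversions≡inv : {n : ℕ} (σ : Perm n) → inversions σ ≡ inv (σ ⟨$⟩ʳ_)
inversions≡inv {n} σ = begin
    inversions σ
  ≡⟨ length-filterᵇ inverted (cartesianProduct (allFin n) (allFin n)) ⟩
    count inverted (cartesianProduct (allFin n) (allFin n))
  ≡⟨ count-cartesianProduct inverted id (allFin n) ⟩
    sum (λ i → count (λ j → inverted (i , j)) (allFin n))
  ≡⟨ sum-cong-≗ (λ i → count-tabulate (λ j → inverted (i , j)) id) ⟩
    inv (σ ⟨$⟩ʳ_) ∎
  where
  open ≡-Reasoning
  inverted : Fin n × Fin n → Bool
  inverted p = proj₁ p <ᶠ proj₂ p ∧ (σ ⟨$⟩ʳ proj₂ p) <ᶠ (σ ⟨$⟩ʳ proj₁ p)

count₂-cong : {n : ℕ} {P Q : Fin n → Fin n → Bool} → (∀ i j → P i j ≡ Q i j) → count₂ P ≡ count₂ Q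
count₂-cong P≡Q = sum-cong-≗ (λ i → sum-cong-≗ (λ j → cong 𝟙 (P≡Q i j)))

inv-cong : {n : ℕ} {f g : Fin n → Fin n} → (∀ x → f x ≡ g x) → inv f ≡ inv g
inv-cong {f = f} {g} f≡g = count₂-cong (λ i j → cong₂ (λ u v → i <ᶠ j ∧ u <ᶠ v) (f≡g j) (f≡g i))

∑∑-distrib-+ : {n : ℕ} (f g : Fin n → Fin n → ℕ) →
  sum (λ i → sum (λ j → f i j + g i j)) ≡ sum (λ i → sum (f i)) + sum (λ i → sum (g i))
∑∑-distrib-+ f g = trans (sum-cong-≗ (λ i → ∑-distrib-+ (f i) (g i))) (∑-distrib-+ (λ i → sum (f i)) (λ i → sum (g i)))

∑∑-distrib-* : {n : ℕ} (c : ℕ) (f : Fin n → Fin n → ℕ) →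
  sum (λ i → sum (λ j → c * f i j)) ≡ c * sum (λ i → sum (f i))
∑∑-distrib-* c f = sym (trans (*-distribˡ-sum c (λ i → sum (f i))) (sum-cong-≗ (λ i → *-distribˡ-sum c (f i))))

count₂-xor : {n : ℕ} (P Q : Fin n → Fin n → Bool) →
  count₂ (λ i j → P i j xor Q i j) + 2 * count₂ (λ i j → P i j ∧ Q i j) ≡ count₂ P + count₂ Q
count₂-xor P Q = begin
    count₂ (λ i j → P i j xor Q i j) + 2 * count₂ (λ i j → P i j ∧ Q i j)
  ≡⟨ cong (count₂ (λ i j → P i j xor Q i j) +_) (sym (∑∑-distrib-* 2 (λ i j → 𝟙 (P i j ∧ Q i j)))) ⟩
    count₂ (λ i j → P i j xor Q i j) + sum (λ i → sum (λ j → 2 * 𝟙 (P i j ∧ Q i j)))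
  ≡⟨ sym (∑∑-distrib-+ (λ i j → 𝟙 (P i j xor Q i j)) (λ i j → 2 * 𝟙 (P i j ∧ Q i j))) ⟩
    sum (λ i → sum (λ j → 𝟙 (P i j xor Q i j) + 2 * 𝟙 (P i j ∧ Q i j)))
  ≡⟨ sum-cong-≗ (λ i → sum-cong-≗ (λ j → pointwise (P i j) (Q i j))) ⟩
    sum (λ i → sum (λ j → 𝟙 (P i j) + 𝟙 (Q i j)))
  ≡⟨ ∑∑-distrib-+ (λ i j → 𝟙 (P i j)) (λ i j → 𝟙 (Q i j)) ⟩
    count₂ P + count₂ Q ∎
  where
  open ≡-Reasoning
  pointwise : ∀ a b → 𝟙 (a xor b) + 2 * 𝟙 (a ∧ b) ≡ 𝟙 a + 𝟙 b
  pointwise true  true  = refl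
  pointwise true  false = refl
  pointwise false true  = refl
  pointwise false false = refl

split-diagonal : {n : ℕ} (G : Fin n → Fin n → Bool) → (∀ i → G i i ≡ false) → ∀ i j →
  𝟙 (G i j) ≡ 𝟙 (i <ᶠ j ∧ G i j) + 𝟙 (j <ᶠ i ∧ G i j)
split-diagonal G irrefl i j with i <ᶠ j in i<j | j <ᶠ i in j<i
... | true  | true  = ⊥-elim (true≢false (trans (sym (cong₂ _∧_ i<j j<i)) (<ᵇ-asym (toℕ i) (toℕ j))))
  where true≢false : true ≢ false
        true≢false ()
... | true  | false = sym (+-comm (𝟙 (G i j)) 0)
... | false | true  = refl
... | false | false with toℕ-injective (<ᵇ-tri (toℕ i) (toℕ j) i<j j<i)
... | refl = cong 𝟙 (irrefl i)

count₂-symmetric : {n : ℕ} (G : Fin n → Fin n → Bool) → (∀ i → G i i ≡ false) → (∀ i j → G i j ≡ G j i) →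
  count₂ G ≡ 2 * count₂ (λ i j → i <ᶠ j ∧ G i j)
count₂-symmetric G irrefl sym-G = begin
    count₂ G
  ≡⟨ sum-cong-≗ (λ i → sum-cong-≗ (λ j → split-diagonal G irrefl i j)) ⟩
    sum (λ i → sum (λ j → 𝟙 (i <ᶠ j ∧ G i j) + 𝟙 (j <ᶠ i ∧ G i j)))
  ≡⟨ ∑∑-distrib-+ (λ i j → 𝟙 (i <ᶠ j ∧ G i j)) (λ i j → 𝟙 (j <ᶠ i ∧ G i j)) ⟩
    U + count₂ (λ i j → j <ᶠ i ∧ G i j)
  ≡⟨ cong (U +_) (count₂-cong (λ i j → cong (j <ᶠ i ∧_) (sym-G i j))) ⟩
    U + count₂ (λ i j → j <ᶠ i ∧ G j i)
  ≡⟨ cong (U +_) (∑-comm (λ i j → 𝟙 (j <ᶠ i ∧ G j i))) ⟩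
    U + U
  ≡⟨ cong (U +_) (sym (+-identityʳ U)) ⟩
    2 * U ∎
  where
  open ≡-Reasoning
  U = count₂ (λ i j → i <ᶠ j ∧ G i j)

count₂-permute : {n : ℕ} (P : Fin n → Fin n → Bool) (s : Permutation′ n) →
  count₂ P ≡ count₂ (λ i j → P (s ⟨$⟩ʳ i) (s ⟨$⟩ʳ j))
count₂-permute P s = trans (sum-cong-≗ (λ x → sum-permute (λ y → 𝟙 (P x y)) s))
                           (sum-permute (λ x → sum (λ j → 𝟙 (P x (s ⟨$⟩ʳ j)))) s)

reverses : {n : ℕ} → (Fin n → Fin n) → Fin n → Fin n → Bool
reverses h x y = h y <ᶠ h x xor y <ᶠ x

reverses-irrefl : {n : ℕ} (h : Fin n → Fin n) (x : Fin n) → reverses h x x ≡ false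
reverses-irrefl h x rewrite <ᵇ-irrefl (toℕ (h x)) | <ᵇ-irrefl (toℕ x) = refl

reverses-sym : {n : ℕ} (h : Fin n → Fin n) → Injective _≡_ _≡_ h → ∀ x y → reverses h x y ≡ reverses h y x
reverses-sym h h-inj x y with x ≟ y
... | yes refl = refl
... | no x≢y = trans (cong₂ _xor_ (<ᵇ-flip (toℕ (h x)) (toℕ (h y)) (x≢y ∘ h-inj ∘ toℕ-injective))
                                  (<ᵇ-flip (toℕ x) (toℕ y) (x≢y ∘ toℕ-injective)))
                     (not-xor-not (h x <ᶠ h y) (x <ᶠ y))
  where
  not-xor-not : ∀ a b → (not a xor not b) ≡ (a xor b)
  not-xor-not true  b = refl
  not-xor-not false b = not-involutive b

reverses-above : {n : ℕ} (h : Fin n → Fin n) (x y : Fin n) →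
  (x <ᶠ y ∧ reverses h x y) ≡ (x <ᶠ y ∧ h y <ᶠ h x)
reverses-above h x y with x <ᶠ y in x<y
... | false = refl
... | true  = trans (cong (h y <ᶠ h x xor_) y≮x) (xor-identityʳ (h y <ᶠ h x))
  where
  y≮x : y <ᶠ x ≡ false
  y≮x = trans (sym (cong (_∧ y <ᶠ x) x<y)) (<ᵇ-asym (toℕ x) (toℕ y))

count₂-reverses : {n : ℕ} (h : Fin n → Fin n) → Injective _≡_ _≡_ h → count₂ (reverses h) ≡ 2 * inv h
count₂-reverses h h-inj = trans (count₂-symmetric (reverses h) (reverses-irrefl h) (reverses-sym h h-inj))
                                (cong (2 *_) (count₂-cong (reverses-above h)))

reverses-relabel : {n : ℕ} (h : Fin n → Fin n) → Injective _≡_ _≡_ h → (s : Permutation′ n) →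
  count₂ (λ i j → i <ᶠ j ∧ reverses h (s ⟨$⟩ʳ i) (s ⟨$⟩ʳ j)) ≡ inv h
reverses-relabel h h-inj s = *-cancelˡ-≡ _ _ 2 (begin
    2 * count₂ (λ i j → i <ᶠ j ∧ G i j)
  ≡⟨ sym (count₂-symmetric G (λ i → reverses-irrefl h (s ⟨$⟩ʳ i))
                             (λ i j → reverses-sym h h-inj (s ⟨$⟩ʳ i) (s ⟨$⟩ʳ j))) ⟩
    count₂ G
  ≡⟨ sym (count₂-permute (reverses h) s) ⟩
    count₂ (reverses h)
  ≡⟨ count₂-reverses h h-inj ⟩
    2 * inv h ∎)
  where
  open ≡-Reasoning
  G = λ i j → reverses h (s ⟨$⟩ʳ i) (s ⟨$⟩ʳ j)

inv-∘ : {n : ℕ} (h : Fin n → Fin n) → Injective _≡_ _≡_ h → (s : Permutation′ n) →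
  ∃ λ z → inv (h ∘ (s ⟨$⟩ʳ_)) + 2 * z ≡ inv h + inv (s ⟨$⟩ʳ_)
inv-∘ h h-inj s = count₂ (λ i j → A i j ∧ B i j) , (begin
    inv (h ∘ (s ⟨$⟩ʳ_)) + 2 * count₂ (λ i j → A i j ∧ B i j)
  ≡⟨ cong (_+ 2 * count₂ (λ i j → A i j ∧ B i j)) (count₂-cong split) ⟩
    count₂ (λ i j → A i j xor B i j) + 2 * count₂ (λ i j → A i j ∧ B i j)
  ≡⟨ count₂-xor A B ⟩
    count₂ A + count₂ B
  ≡⟨ cong (_+ count₂ B) (reverses-relabel h h-inj s) ⟩
    inv h + inv (s ⟨$⟩ʳ_) ∎)
  where
  open ≡-Reasoning
  A B : Fin _ → Fin _ → Bool
  A i j = i <ᶠ j ∧ reverses h (s ⟨$⟩ʳ i) (s ⟨$⟩ʳ j)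
  B i j = i <ᶠ j ∧ (s ⟨$⟩ʳ j) <ᶠ (s ⟨$⟩ʳ i)
  -- an inversion of h ∘ s is reversed by exactly one of h (on the s-images) and s
  split : ∀ i j → (i <ᶠ j ∧ h (s ⟨$⟩ʳ j) <ᶠ h (s ⟨$⟩ʳ i)) ≡ (A i j xor B i j)
  split i j = begin
      i <ᶠ j ∧ c
    ≡⟨ cong (i <ᶠ j ∧_) (sym (trans (xor-assoc c b b) (trans (cong (c xor_) (xor-same b)) (xor-identityʳ c)))) ⟩
      i <ᶠ j ∧ ((c xor b) xor b)
    ≡⟨ ∧-distribˡ-xor (i <ᶠ j) (c xor b) b ⟩
      A i j xor B i j ∎
    where
    b = (s ⟨$⟩ʳ j) <ᶠ (s ⟨$⟩ʳ i)
    c = h (s ⟨$⟩ʳ j) <ᶠ h (s ⟨$⟩ʳ i)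

parity-+-double : ∀ m z → parity (m + 2 * z) ≡ parity m
parity-+-double m z = begin
    parity (m + 2 * z)
  ≡⟨ ℙ.+-homo-+ m (2 * z) ⟩
    parity m ℙ.+ parity (2 * z)
  ≡⟨ cong (parity m ℙ.+_) (ℙ.*-homo-* 2 z) ⟩
    parity m ℙ.+ 0ℙ
  ≡⟨ ℙ.+-identityʳ (parity m) ⟩
    parity m ∎
  where open ≡-Reasoning

inv-∘-parity : {n : ℕ} (h : Fin n → Fin n) → Injective _≡_ _≡_ h → (s : Permutation′ n) →
  parity (inv (h ∘ (s ⟨$⟩ʳ_))) ≡ parity (inv h) ℙ.+ parity (inv (s ⟨$⟩ʳ_))
inv-∘-parity h h-inj s with inv-∘ h h-inj s
... | z , eq = trans (sym (parity-+-double (inv (h ∘ (s ⟨$⟩ʳ_))) z))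
                     (trans (cong parity eq) (ℙ.+-homo-+ (inv h) (inv (s ⟨$⟩ʳ_))))

parity≡0⇒even : ∀ m → parity m ≡ 0ℙ → 2 ∣ m
parity≡0⇒even zero          _ = divides 0 refl
parity≡0⇒even (suc zero)    ()
parity≡0⇒even (suc (suc m)) p with parity≡0⇒even m p
... | divides k m≡k*2 = divides (suc k) (cong (λ z → suc (suc z)) m≡k*2)

even⇒parity≡0 : ∀ m → 2 ∣ m → parity m ≡ 0ℙ
even⇒parity≡0 .(k * 2) (divides k refl) = trans (ℙ.*-homo-* k 2) (ℙ.*-zeroʳ (parity k))

sign : {n : ℕ} → Perm n → Parity
sign σ = parity (inv (σ ⟨$⟩ʳ_))

sign≡0⇒even : {n : ℕ} (σ : Perm n) → sign σ ≡ 0ℙ → IsEven σ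
sign≡0⇒even σ p = subst (2 ∣_) (sym (inversions≡inv σ)) (parity≡0⇒even _ p)

even⇒sign≡0 : {n : ℕ} (σ : Perm n) → IsEven σ → sign σ ≡ 0ℙ
even⇒sign≡0 σ e = even⇒parity≡0 _ (subst (2 ∣_) (inversions≡inv σ) e)

perm-injective : {n : ℕ} (σ : Perm n) → Injective _≡_ _≡_ (σ ⟨$⟩ʳ_)
perm-injective σ σx≡σy = trans (sym (inverseˡ σ)) (trans (cong (σ ⟨$⟩ˡ_) σx≡σy) (inverseˡ σ))

even-quotient : {n : ℕ} (g h s : Perm n) → (∀ i → h ⟨$⟩ʳ i ≡ g ⟨$⟩ʳ (s ⟨$⟩ʳ i)) →
  IsEven g → IsEven h → IsEven s
even-quotient g h s h≡sg g-even h-even = sign≡0⇒even s (begin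
    sign s
  ≡⟨ cong (ℙ._+ sign s) (sym (even⇒sign≡0 g g-even)) ⟩
    sign g ℙ.+ sign s
  ≡⟨ sym (inv-∘-parity (g ⟨$⟩ʳ_) (perm-injective g) s) ⟩
    parity (inv ((g ⟨$⟩ʳ_) ∘ (s ⟨$⟩ʳ_)))
  ≡⟨ cong parity (inv-cong (λ i → sym (h≡sg i))) ⟩
    sign h
  ≡⟨ even⇒sign≡0 h h-even ⟩
    0ℙ ∎)
  where open ≡-Reasoning

agree⇒fixed : {n : ℕ} (g h s : Perm n) → (∀ i → h ⟨$⟩ʳ i ≡ g ⟨$⟩ʳ (s ⟨$⟩ʳ i)) →
  ∀ x → g ⟨$⟩ʳ x ≡ h ⟨$⟩ʳ x → s ⟨$⟩ʳ x ≡ x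
agree⇒fixed g h s h≡sg x gx≡hx = sym (perm-injective g (trans gx≡hx (h≡sg x)))

adjacent⇒disagree : {n : ℕ} (g h : Alt n) → AΓ-Adj g h → ∀ x → proj₁ g ⟨$⟩ʳ x ≢ proj₁ h ⟨$⟩ʳ x
adjacent⇒disagree (g , _) (h , _) (inj₁ (s , s-fpf , h≡sg)) x gx≡hx =
  s-fpf x (agree⇒fixed g h (proj₁ s) h≡sg x gx≡hx)
adjacent⇒disagree (g , _) (h , _) (inj₂ (s , s-fpf , g≡sh)) x gx≡hx =
  s-fpf x (agree⇒fixed h g (proj₁ s) g≡sh x (sym gx≡hx))

disagree⇒adjacent : {n : ℕ} (g h : Alt n) → (∀ x → proj₁ g ⟨$⟩ʳ x ≢ proj₁ h ⟨$⟩ʳ x) → AΓ-Adj g h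
disagree⇒adjacent (g , g-even) (h , h-even) disagree =
  inj₁ ((s , even-quotient g h s h≡sg g-even h-even) , s-fpf , h≡sg)
  where
  s : Perm _
  s = h ∘ₚ flip g
  h≡sg : ∀ i → h ⟨$⟩ʳ i ≡ g ⟨$⟩ʳ (s ⟨$⟩ʳ i)
  h≡sg i = sym (inverseʳ g)
  s-fpf : FixedPointFree s
  s-fpf x sx≡x = disagree x (sym (trans (h≡sg x) (cong (g ⟨$⟩ʳ_) sx≡x)))

cyclic-pred : {m : ℕ} → Fin (suc m) → Fin (suc m)
cyclic-pred {m} zero    = fromℕ m
cyclic-pred     (suc i) = inject₁ i

cyclic-suc : {m : ℕ} → Fin (suc m) → Fin (suc m)
cyclic-suc {zero}  zero    = zero
cyclic-suc {suc m} zero    = suc zero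
cyclic-suc {suc m} (suc i) with cyclic-suc {m} i
... | zero  = zero
... | suc r = suc (suc r)

cyclic-pred-suc : {m : ℕ} (i : Fin (suc m)) → cyclic-pred (cyclic-suc i) ≡ i
cyclic-pred-suc {zero}  zero    = refl
cyclic-pred-suc {suc m} zero    = refl
cyclic-pred-suc {suc m} (suc i) with cyclic-suc {m} i | cyclic-pred-suc {m} i
... | zero  | eq = cong suc eq
... | suc r | eq = cong suc eq

cyclic-suc-last : ∀ m → cyclic-suc (fromℕ m) ≡ zero
cyclic-suc-last zero = refl
cyclic-suc-last (suc m) with cyclic-suc {m} (fromℕ m) | cyclic-suc-last m
... | zero | _ = refl

cyclic-suc-pred : {m : ℕ} (i : Fin (suc m)) → cyclic-suc (cyclic-pred i) ≡ i
cyclic-suc-pred {zero}  zero = refl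
cyclic-suc-pred {suc m} zero with cyclic-suc {m} (fromℕ m) | cyclic-suc-last m
... | zero | _ = refl
cyclic-suc-pred {suc m} (suc zero) = refl
cyclic-suc-pred {suc m} (suc (suc i)) with cyclic-suc {m} (inject₁ i) | cyclic-suc-pred {m} (suc i)
... | suc r | eq = cong suc eq

rotation : {m : ℕ} → Permutation′ (suc m)
rotation = permutation cyclic-pred cyclic-suc cyclic-pred-suc cyclic-suc-pred

cyclic-pred-value : {m : ℕ} (y : Fin (suc m)) → ∃ λ e → toℕ (cyclic-pred y) + 1 ≡ toℕ y + e * suc m
cyclic-pred-value {m} zero    =
  1 , trans (cong (_+ 1) (toℕ-fromℕ m)) (trans (+-comm m 1) (cong suc (sym (+-identityʳ m))))
cyclic-pred-value     (suc i) =
  0 , trans (cong (_+ 1) (toℕ-inject₁ i)) (trans (+-comm (toℕ i) 1) (sym (+-identityʳ (suc (toℕ i)))))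

sum-const : {n : ℕ} (f : Fin n → ℕ) (c : ℕ) → (∀ i → f i ≡ c) → sum f ≡ n * c
sum-const {zero}  f c f≡c = refl
sum-const {suc n} f c f≡c = cong₂ _+_ (f≡c zero) (sum-const (f ∘ suc) c (f≡c ∘ suc))

sum-zero : {n : ℕ} (f : Fin n → ℕ) → (∀ i → f i ≡ 0) → sum f ≡ 0
sum-zero {n} f f≡0 = trans (sum-const f 0 f≡0) (*-zeroʳ n)

<ᵇ-true : ∀ {a b} → a < b → (a <ᵇ b) ≡ true
<ᵇ-true {zero}  {suc b} _         = refl
<ᵇ-true {suc a} {suc b} (s≤s a<b) = <ᵇ-true a<b

-- The only inversions of the (m + 1)-cycle are the pairs (0 , j).
inv-cyclic-pred : ∀ m → inv (cyclic-pred {m}) ≡ m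
inv-cyclic-pred m = begin
    sum {m} (λ j → 𝟙 (inject₁ j <ᶠ fromℕ m))
      + sum {m} (λ i → sum {m} (λ j → 𝟙 (i <ᶠ j ∧ inject₁ j <ᶠ inject₁ i)))
  ≡⟨ cong₂ _+_ (sum-const _ 1 (λ j → cong 𝟙 (first-row j)))
               (sum-zero _ (λ i → sum-zero _ (λ j → cong 𝟙 (later-rows i j)))) ⟩
    m * 1 + 0
  ≡⟨ trans (+-identityʳ (m * 1)) (*-identityʳ m) ⟩
    m ∎
  where
  open ≡-Reasoning
  first-row : (j : Fin m) → inject₁ j <ᶠ fromℕ m ≡ true
  first-row j = trans (cong₂ _<ᵇ_ (toℕ-inject₁ j) (toℕ-fromℕ m)) (<ᵇ-true (toℕ<n j))
  later-rows : (i j : Fin m) → (i <ᶠ j ∧ inject₁ j <ᶠ inject₁ i) ≡ false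
  later-rows i j = trans (cong₂ (λ u v → i <ᶠ j ∧ (u <ᵇ v)) (toℕ-inject₁ j) (toℕ-inject₁ i)) (<ᵇ-asym (toℕ i) (toℕ j))

swap02 : {k : ℕ} → Fin (3 + k) → Fin (3 + k)
swap02 zero                = suc (suc zero)
swap02 (suc zero)          = suc zero
swap02 (suc (suc zero))    = zero
swap02 (suc (suc (suc i))) = suc (suc (suc i))

swap02-involutive : {k : ℕ} (i : Fin (3 + k)) → swap02 (swap02 i) ≡ i
swap02-involutive zero                = refl
swap02-involutive (suc zero)          = refl
swap02-involutive (suc (suc zero))    = refl
swap02-involutive (suc (suc (suc i))) = refl

swap02-injective : {k : ℕ} → Injective _≡_ _≡_ (swap02 {k})
swap02-injective {x = x} {y} e = trans (sym (swap02-involutive x)) (trans (cong swap02 e) (swap02-involutive y))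

swap02-parity : {k : ℕ} (i : Fin (3 + k)) → parity (toℕ (swap02 i)) ≡ parity (toℕ i)
swap02-parity zero                = refl
swap02-parity (suc zero)          = refl
swap02-parity (suc (suc zero))    = refl
swap02-parity (suc (suc (suc i))) = refl

-- The inversions of (0 2) are (0 , 1), (0 , 2) and (1 , 2).
inv-swap02 : ∀ k → inv (swap02 {k}) ≡ 3
inv-swap02 k = cong₂ _+_ (cong (2 +_) (sum-zero {k} _ (λ _ → refl)))
              (cong₂ _+_ (cong (1 +_) (sum-zero {k} _ (λ _ → refl)))
              (cong₂ _+_ (sum-zero {k} _ (λ _ → refl))
                         (sum-zero {k} _ (λ i → sum-zero {k} _ (λ j → cong 𝟙 (<ᵇ-asym (toℕ i) (toℕ j)))))))

inv-id : {n : ℕ} → inv {n} id ≡ 0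
inv-id {n} = sum-zero {n} _ (λ i → sum-zero {n} _ (λ j → cong 𝟙 (<ᵇ-asym (toℕ i) (toℕ j))))

+-swapʳ : ∀ u v w → u + v + w ≡ u + w + v
+-swapʳ = solve-∀

rotation^ : {m : ℕ} → ℕ → Permutation′ (suc m)
rotation^ zero    = idₚ
rotation^ (suc a) = rotation^ a ∘ₚ rotation

rotation^-value : {m : ℕ} (a : ℕ) (x : Fin (suc m)) →
  ∃ λ K → toℕ (rotation^ a ⟨$⟩ʳ x) + a ≡ toℕ x + K * suc m
rotation^-value zero x = 0 , refl
rotation^-value {m} (suc a) x with rotation^-value a x | cyclic-pred-value (rotation^ a ⟨$⟩ʳ x)
... | K , eK | e , ee = K + e , (begin
    toℕ (cyclic-pred y) + suc a
  ≡⟨ +-suc-shift (toℕ (cyclic-pred y)) a ⟩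
    (toℕ (cyclic-pred y) + 1) + a
  ≡⟨ cong (_+ a) ee ⟩
    (toℕ y + e * suc m) + a
  ≡⟨ +-swapʳ (toℕ y) (e * suc m) a ⟩
    (toℕ y + a) + e * suc m
  ≡⟨ cong (_+ e * suc m) eK ⟩
    (toℕ x + K * suc m) + e * suc m
  ≡⟨ collect (toℕ x) K e (suc m) ⟩
    toℕ x + (K + e) * suc m ∎)
  where
  open ≡-Reasoning
  y = rotation^ a ⟨$⟩ʳ x
  +-suc-shift : ∀ c a → c + suc a ≡ (c + 1) + a
  +-suc-shift = solve-∀
  collect : ∀ u K e N → (u + K * N) + e * N ≡ u + (K + e) * N
  collect = solve-∀

residue-unique : {N a b : ℕ} (K L : ℕ) → a < suc N → b < suc N → a + K * suc N ≡ b + L * suc N → a ≡ b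
residue-unique {N} {a} {b} K L a<N+1 b<N+1 eq = begin
    a                       ≡⟨ sym (m<n⇒m%n≡m a<N+1) ⟩
    a % suc N               ≡⟨ sym ([m+kn]%n≡m%n a K (suc N)) ⟩
    (a + K * suc N) % suc N ≡⟨ cong (_% suc N) eq ⟩
    (b + L * suc N) % suc N ≡⟨ [m+kn]%n≡m%n b L (suc N) ⟩
    b % suc N               ≡⟨ m<n⇒m%n≡m b<N+1 ⟩
    b                       ∎
  where open ≡-Reasoning

rotation^-latin : {m : ℕ} (a b : ℕ) (x : Fin (suc m)) → a < suc m → b < suc m →
  rotation^ a ⟨$⟩ʳ x ≡ rotation^ b ⟨$⟩ʳ x → a ≡ b
rotation^-latin {m} a b x a<N b<N same
  with rotation^-value a x | rotation^-value b x
... | K , eK | L , eL = residue-unique L K a<N b<N (+-cancelˡ-≡ y _ _ (begin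
    y + (a + L * N)       ≡⟨ sym (+-assoc y a (L * N)) ⟩
    y + a + L * N         ≡⟨ cong (_+ L * N) eK ⟩
    toℕ x + K * N + L * N ≡⟨ +-swapʳ (toℕ x) (K * N) (L * N) ⟩
    toℕ x + L * N + K * N ≡⟨ cong (_+ K * N) (sym (trans (cong (λ z → toℕ z + b) same) eL)) ⟩
    y + b + K * N         ≡⟨ +-assoc y b (K * N) ⟩
    y + (b + K * N)       ∎))
  where
  open ≡-Reasoning
  N = suc m
  y = toℕ (rotation^ a ⟨$⟩ʳ x)

rotation^-sign : {m : ℕ} (a : ℕ) → sign (rotation^ {m} a) ≡ parity (a * m)
rotation^-sign {m} zero = cong parity (inv-id {suc m})
rotation^-sign {m} (suc a) = begin
    parity (inv (cyclic-pred ∘ (rotation^ {m} a ⟨$⟩ʳ_)))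
  ≡⟨ inv-∘-parity cyclic-pred (perm-injective (rotation {m})) (rotation^ a) ⟩
    parity (inv (cyclic-pred {m})) ℙ.+ sign (rotation^ {m} a)
  ≡⟨ cong₂ ℙ._+_ (cong parity (inv-cyclic-pred m)) (rotation^-sign {m} a) ⟩
    parity m ℙ.+ parity (a * m)
  ≡⟨ sym (ℙ.+-homo-+ m (a * m)) ⟩
    parity (suc a * m) ∎
  where open ≡-Reasoning

rotation^-value-parity : {m : ℕ} → parity (suc m) ≡ 0ℙ → (a : ℕ) (x : Fin (suc m)) →
  parity (toℕ (rotation^ a ⟨$⟩ʳ x)) ℙ.+ parity a ≡ parity (toℕ x)
rotation^-value-parity {m} N-even a x with rotation^-value a x
... | K , eK = begin
    parity (toℕ (rotation^ a ⟨$⟩ʳ x)) ℙ.+ parity a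
  ≡⟨ sym (ℙ.+-homo-+ (toℕ (rotation^ a ⟨$⟩ʳ x)) a) ⟩
    parity (toℕ (rotation^ a ⟨$⟩ʳ x) + a)
  ≡⟨ cong parity eK ⟩
    parity (toℕ x + K * suc m)
  ≡⟨ trans (ℙ.+-homo-+ (toℕ x) (K * suc m)) (cong (parity (toℕ x) ℙ.+_) (ℙ.*-homo-* K (suc m))) ⟩
    parity (toℕ x) ℙ.+ (parity K ℙ.* parity (suc m))
  ≡⟨ cong (λ p → parity (toℕ x) ℙ.+ (parity K ℙ.* p)) N-even ⟩
    parity (toℕ x) ℙ.+ (parity K ℙ.* 0ℙ)
  ≡⟨ trans (cong (parity (toℕ x) ℙ.+_) (ℙ.*-zeroʳ (parity K))) (ℙ.+-identityʳ (parity (toℕ x))) ⟩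
    parity (toℕ x) ∎
  where open ≡-Reasoning

module LatinRows (k : ℕ) where

  n m : ℕ
  n = 3 + k
  m = 2 + k

  rot : ℕ → Permutation′ n
  rot = rotation^ {m}

  transposition02 : Permutation′ n
  transposition02 = permutation swap02 swap02 swap02-involutive swap02-involutive

  -- Follow σ by (0 2) when the tag is odd; this corrects an odd σ into an even permutation.
  twist : Parity → Permutation′ n → Permutation′ n
  twist 0ℙ σ = σ
  twist 1ℙ σ = σ ∘ₚ transposition02

  twist-even : (σ : Permutation′ n) → sign (twist (sign σ) σ) ≡ 0ℙ
  twist-even σ with sign σ in sign-σ
  ... | 0ℙ = sign-σ
  ... | 1ℙ = trans (inv-∘-parity swap02 swap02-injective σ)
                   (cong₂ ℙ._+_ (cong parity (inv-swap02 k)) sign-σ)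

  twist-value-parity : (p : Parity) (σ : Permutation′ n) (x : Fin n) →
    parity (toℕ (twist p σ ⟨$⟩ʳ x)) ≡ parity (toℕ (σ ⟨$⟩ʳ x))
  twist-value-parity 0ℙ σ x = refl
  twist-value-parity 1ℙ σ x = swap02-parity (σ ⟨$⟩ʳ x)

  untwist : {p q : Parity} (σ τ : Permutation′ n) (x : Fin n) → p ≡ q →
    twist p σ ⟨$⟩ʳ x ≡ twist q τ ⟨$⟩ʳ x → σ ⟨$⟩ʳ x ≡ τ ⟨$⟩ʳ x
  untwist {p = 0ℙ} σ τ x refl e = e
  untwist {p = 1ℙ} σ τ x refl e = swap02-injective e

  -- The rows of an n × n Latin square of even permutations: the powers of the
  -- n-cycle, each twisted by (0 2) when it is odd (which happens only for n even).
  row : ℕ → Permutation′ n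
  row a = twist (sign (rot a)) (rot a)

  row-even : (a : ℕ) → IsEven (row a)
  row-even a = sign≡0⇒even (row a) (twist-even (rot a))

  row-tags-agree : (a b : ℕ) (x : Fin n) → row a ⟨$⟩ʳ x ≡ row b ⟨$⟩ʳ x →
    sign (rot a) ≡ sign (rot b)
  row-tags-agree a b x same = begin
      sign (rot a)          ≡⟨ rotation^-sign a ⟩
      parity (a * m)        ≡⟨ ℙ.*-homo-* a m ⟩
      parity a ℙ.* parity m ≡⟨ tags (parity m) refl ⟩
      parity b ℙ.* parity m ≡⟨ sym (ℙ.*-homo-* b m) ⟩
      parity (b * m)        ≡⟨ sym (rotation^-sign b) ⟩
      sign (rot b)          ∎
    where
    open ≡-Reasoning
    value-parity : (c : ℕ) → parity (toℕ (row c ⟨$⟩ʳ x)) ≡ parity (toℕ (rot c ⟨$⟩ʳ x))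
    value-parity c = twist-value-parity (sign (rot c)) (rot c) x
    -- the tags are parity a * parity m and parity b * parity m; for m odd compare value parities
    tags : (p : Parity) → parity m ≡ p → parity a ℙ.* p ≡ parity b ℙ.* p
    tags 0ℙ _ = trans (ℙ.*-zeroʳ (parity a)) (sym (ℙ.*-zeroʳ (parity b)))
    tags 1ℙ m-odd = trans (ℙ.*-identityʳ (parity a)) (trans a≡b (sym (ℙ.*-identityʳ (parity b))))
      where
      n-even : parity (suc m) ≡ 0ℙ
      n-even = ℙ.⁻¹-injective (trans (ℙ.suc-homo-⁻¹ m) m-odd)
      rot-values-same-parity : parity (toℕ (rot b ⟨$⟩ʳ x)) ≡ parity (toℕ (rot a ⟨$⟩ʳ x))
      rot-values-same-parity =
        trans (sym (value-parity b)) (trans (cong (parity ∘ toℕ) (sym same)) (value-parity a))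
      a≡b : parity a ≡ parity b
      a≡b = ℙ.+-cancelˡ-≡ (parity (toℕ (rot a ⟨$⟩ʳ x))) _ _ (begin
          parity (toℕ (rot a ⟨$⟩ʳ x)) ℙ.+ parity a
        ≡⟨ rotation^-value-parity n-even a x ⟩
          parity (toℕ x)
        ≡⟨ sym (rotation^-value-parity n-even b x) ⟩
          parity (toℕ (rot b ⟨$⟩ʳ x)) ℙ.+ parity b
        ≡⟨ cong (ℙ._+ parity b) rot-values-same-parity ⟩
          parity (toℕ (rot a ⟨$⟩ʳ x)) ℙ.+ parity b ∎)

  row-latin : (a b : ℕ) (x : Fin n) → a < n → b < n →
    row a ⟨$⟩ʳ x ≡ row b ⟨$⟩ʳ x → a ≡ b
  row-latin a b x a<n b<n same =
    rotation^-latin a b x a<n b<n (untwist (rot a) (rot b) x (row-tags-agree a b x same) same)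

clique≤colours : {V : Set} (_≈_ : V → V → Set) (Adj : V → V → Set) (ω χ : ℕ) (c : Fin ω → V) (f : V → Fin χ) →
  IsClique _≈_ Adj ω c → IsProperColouring Adj χ f → ω ≤ χ
clique≤colours _≈_ Adj ω χ c f clique proper with ω ≤? χ
... | yes ω≤χ = ω≤χ
... | no ω≰χ with pigeonhole (≰⇒> ω≰χ) (f ∘ c)
...   | i , j , i<j , same-colour = ⊥-elim (proper (c i) (c j) (proj₂ (clique i j (<⇒≢ i<j))) same-colour)

clique+colouring⇒ω≡χ : {V : Set} (_≈_ : V → V → Set) (Adj : V → V → Set) (n : ℕ) →
  Σ (Fin n → V) (IsClique _≈_ Adj n) → Σ (V → Fin n) (IsProperColouring Adj n) →
  IsCliqueNumber _≈_ Adj n × IsChromaticNumber Adj n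
clique+colouring⇒ω≡χ _≈_ Adj n (c , clique) (f , proper) =
  ((c , clique) , λ ω c′ clique′ → clique≤colours _≈_ Adj ω n c′ f clique′ proper) ,
  ((f , proper) , λ χ f′ proper′ → clique≤colours _≈_ Adj n χ c f′ clique proper′)

AΓq-ω≡χ≡n : (k q : ℕ) →
  IsCliqueNumber (_≈ᵥ_ {3 + k} {suc q}) AΓq-Adj (3 + k) × IsChromaticNumber (AΓq-Adj {3 + k} {suc q}) (3 + k)
AΓq-ω≡χ≡n k q = clique+colouring⇒ω≡χ _≈ᵥ_ AΓq-Adj n (clique , is-clique) (colour , is-proper)
  where
  open LatinRows k
  clique : Fin n → Vtx n (suc q)
  clique i _ = row (toℕ i) , row-even (toℕ i)
  rows-disagree : {i j : Fin n} → i ≢ j → ∀ x → row (toℕ i) ⟨$⟩ʳ x ≢ row (toℕ j) ⟨$⟩ʳ x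
  rows-disagree {i} {j} i≢j x same = i≢j (toℕ-injective (row-latin (toℕ i) (toℕ j) x (toℕ<n i) (toℕ<n j) same))
  is-clique : IsClique _≈ᵥ_ AΓq-Adj n clique
  is-clique i j i≢j = (λ equal → rows-disagree i≢j zero (equal zero zero)) ,
                      (λ _ → disagree⇒adjacent (clique i zero) (clique j zero) (rows-disagree i≢j))
  colour : Vtx n (suc q) → Fin n
  colour v = proj₁ (v zero) ⟨$⟩ʳ zero
  is-proper : IsProperColouring AΓq-Adj n colour
  is-proper u v adjacent = adjacent⇒disagree (u zero) (v zero) (adjacent zero) zero

-- The theorem: n ≥ 5 means n = 3 + (2 + j), and q ≥ 1 means q = suc q′.
corollary3p7 : (n q : ℕ) → 5 ≤ n → 1 ≤ q →
    IsCliqueNumber (_≈ᵥ_ {n} {q}) (AΓq-Adj {n} {q}) n ×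
    IsChromaticNumber (AΓq-Adj {n} {q}) n
corollary3p7 .(5 + j) .(suc q′) (s≤s (s≤s (s≤s (s≤s (s≤s {n = j} z≤n))))) (s≤s {n = q′} z≤n) = AΓq-ω≡χ≡n (2 + j) q′
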